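{- Let $(\mathcal{L},\mathcal{G})$ be an irreducible built lattice, let $\mathcal{S}=\{G_1,\dots,G_n\}$ be an irreducible nested set of $(\mathcal{L},\mathcal{G})$, and for each $i$ let $\mathcal{S}_i$ be an irreducible nested set of the irreducible built lattice $([\tau_{\mathcal{S}}(G_i),G_i],\mathrm{Ind}_{[\tau_{\mathcal{S}}(G_i),G_i]}(\mathcal{G}))$. Then $$\mathcal{S}\circ(\mathcal{S}_i)_i:=\mathcal{S}\cup\bigcup_i\{\mathrm{Comp}_{\tau_{\mathcal{S}}(G_i)}(K): K\in\mathcal{S}_i\}$$ is a nested set of $(\mathcal{L},\mathcal{G})$.
   Context: A finite lattice $\mathcal{L}$ (bottom $\hat 0$, top $\hat 1$) is geometric if all maximal chains between two comparable elements have the same length, the rank function $\rho$ satisfies $\rho(X\wedge Y)+\rho(X\vee Y)\le\rho(X)+\rho(Y)$, and every element is a join of atoms. A building set of $\mathcal{L}$ is a subset $\mathcal{G}\subset\mathcal{L}\setminus\{\hat0\}$ such that for every $X\in\mathcal{L}$, with $\mathrm{Fact}_{\mathcal{G}}(X)$ the set of maximal elements of $\mathcal{G}\cap[\hat0,X]$, the join map $\prod_{G\in\mathrm{Fact}_{\mathcal{G}}(X)}[\hat0,G]\to[\hat0,X]$ is a poset isomorphism; $(\mathcal{L},\mathcal{G})$ is a built lattice, irreducible if $\hat1\in\mathcal{G}$. For $G<G'$, $\mathrm{Ind}_{[G,G']}(\mathcal{G})=\big(\{G\vee F:F\in\mathcal{G}\}\cap[G,G']\big)\setminus\{G\}$,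 a building set of $[G,G']$ containing $G'$ when $G'\in\mathcal{G}$. A subset $\mathcal{S}\subset\mathcal{G}$ is nested if for every antichain $\mathcal{A}\subset\mathcal{S}$ with at least two elements, $\bigvee\mathcal{A}\notin\mathcal{G}$; it is irreducible if it contains the maximal element(s) of $\mathcal{G}$ (i.e. $\hat1$ in the irreducible case). For $G\in\mathcal{S}$, $\tau_{\mathcal{S}}(G):=\bigvee\{G'\in\mathcal{S}:G'<G\}$ (equal to $\hat0$ if this set is empty). For $G<G'$ and $G''\in\mathrm{Ind}_{[G,G']}(\mathcal{G})$, $\mathrm{Comp}_G(G'')$ denotes the unique maximal element $F\in\mathcal{G}$ with $F\vee G=G''$. -}

module Defs where

open import Data.Nat using (ℕ; zero; suc; _+_) renaming (_≤_ to _≤ℕ_)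
open import Data.List using (List; foldr)
open import Data.List.Membership.Propositional using (_∈_)
open import Data.List.Relation.Unary.All using (All)
open import Data.Product using (Σ; _×_; _,_)
open import Data.Sum using (_⊎_)
open import Relation.Nullary using (¬_)
open import Relation.Unary using (Pred; _⊆_)
open import Relation.Binary.PropositionalEquality using (_≡_; _≢_)
open import Relation.Binary.Lattice.Structures using (IsLattice)
open import Relation.Binary.Definitions using (Minimum; Maximum)
open import Level using (0ℓ)

record FiniteLattice : Set₁ where
  field
    Carrier   : Set
    _≤_       : Carrier → Carrier → Set
    _∨_       : Carrier → Carrier → Carrier
    _∧_       : Carrier → Carrier → Carrier
    𝟘         : Carrier
    𝟙         : Carrier
    isLattice : IsLattice _≡_ _≤_ _∨_ _∧_
    minimum   : Minimum _≤_ 𝟘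
    maximum   : Maximum _≤_ 𝟙
    elems     : List Carrier
    complete  : ∀ x → x ∈ elems

  infix  4 _≤_ _<_ _⋖_
  infixr 6 _∨_
  infixr 7 _∧_

  _<_ : Carrier → Carrier → Set
  X < Y = X ≤ Y × X ≢ Y

  _⋖_ : Carrier → Carrier → Set
  X ⋖ Y = X < Y × (∀ Z → X ≤ Z → Z ≤ Y → Z ≡ X ⊎ Z ≡ Y)

  data MaxChain : Carrier → Carrier → ℕ → Set where
    done : ∀ {X} → MaxChain X X zero
    step : ∀ {X Z Y n} → X ⋖ Z → MaxChain Z Y n → MaxChain X Y (suc n)

  Atom : Carrier → Set
  Atom A = 𝟘 ⋖ A

  IsJoinOf : Pred Carrier 0ℓ → Carrier → Set
  IsJoinOf P Y = (∀ Z → P Z → Z ≤ Y) × (∀ W → (∀ Z → P Z → Z ≤ W) → Y ≤ W)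

module _ (L : FiniteLattice) where
  open FiniteLattice L

  Graded : Set
  Graded = ∀ X Y m n → MaxChain X Y m → MaxChain X Y n → m ≡ n

  IsRank : (Carrier → ℕ) → Set
  IsRank ρ = ∀ X n → MaxChain 𝟘 X n → ρ X ≡ n

  record IsGeometric : Set where
    field
      graded       : Graded
      ρ            : Carrier → ℕ
      ρ-isRank     : IsRank ρ
      semimodular  : ∀ X Y → ρ (X ∧ Y) + ρ (X ∨ Y) ≤ℕ ρ X + ρ Y
      atomistic    : ∀ X → Σ (List Carrier) λ as → All Atom as × foldr _∨_ 𝟘 as ≡ X

  Fact : Pred Carrier 0ℓ → Carrier → Carrier → Set
  Fact 𝒢 X G = 𝒢 G × G ≤ X × (∀ H → 𝒢 H → H ≤ X → G ≤ H → H ≡ G)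

  -- An element of ∏_{G ∈ Fact(X)} [𝟘, G] is represented by a function φ,
  -- whose value matters only on Fact(X), with φ G ≤ G there.
  InProd : Pred Carrier 0ℓ → Carrier → (Carrier → Carrier) → Set
  InProd 𝒢 X φ = ∀ G → Fact 𝒢 X G → φ G ≤ G

  -- the set { φ G : G ∈ Fact(X) }, whose join is the image of φ under the join map
  Img : Pred Carrier 0ℓ → Carrier → (Carrier → Carrier) → Pred Carrier 0ℓ
  Img 𝒢 X φ Z = Σ Carrier λ G → Fact 𝒢 X G × φ G ≡ Z

  -- the join map ∏_{G ∈ Fact(X)} [𝟘,G] → [𝟘,X] is a poset isomorphism:
  -- it is surjective onto [𝟘,X] and an order embedding (monotone and order reflecting,
  -- hence injective) for the componentwise order on the product.
  JoinMapIso : Pred Carrier 0ℓ → Carrier → Set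
  JoinMapIso 𝒢 X =
      (∀ Y → Y ≤ X → Σ (Carrier → Carrier) λ φ → InProd 𝒢 X φ × IsJoinOf (Img 𝒢 X φ) Y)
    × (∀ φ ψ Y Z → InProd 𝒢 X φ → InProd 𝒢 X ψ →
         IsJoinOf (Img 𝒢 X φ) Y → IsJoinOf (Img 𝒢 X ψ) Z →
         (Y ≤ Z → ∀ G → Fact 𝒢 X G → φ G ≤ ψ G)
       × ((∀ G → Fact 𝒢 X G → φ G ≤ ψ G) → Y ≤ Z))

  IsBuildingSet : Pred Carrier 0ℓ → Set
  IsBuildingSet 𝒢 = ¬ 𝒢 𝟘 × (∀ X → JoinMapIso 𝒢 X)

  -- Nested sets (for a building set 𝒢 of L, or of an interval of L:
  -- joins of nonempty subsets of an interval agree with joins in L)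

  IsAntichain : Pred Carrier 0ℓ → Set
  IsAntichain A = ∀ X Y → A X → A Y → X ≤ Y → X ≡ Y

  AtLeastTwo : Pred Carrier 0ℓ → Set
  AtLeastTwo A = Σ Carrier λ X → Σ Carrier λ Y → A X × A Y × X ≢ Y

  IsNested : Pred Carrier 0ℓ → Pred Carrier 0ℓ → Set₁
  IsNested 𝒢 S =
      S ⊆ 𝒢
    × (∀ (A : Pred Carrier 0ℓ) → A ⊆ S → IsAntichain A → AtLeastTwo A →
         ∀ Y → IsJoinOf A Y → ¬ 𝒢 Y)

  IsTau : Pred Carrier 0ℓ → Carrier → Carrier → Set
  IsTau S G T = IsJoinOf (λ G' → S G' × G' < G) T

  Ind : Pred Carrier 0ℓ → Carrier → Carrier → Pred Carrier 0ℓ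
  Ind 𝒢 G G' H = (Σ Carrier λ F → 𝒢 F × G ∨ F ≡ H) × G ≤ H × H ≤ G' × H ≢ G

  IsMaxComp : Pred Carrier 0ℓ → Carrier → Carrier → Carrier → Set
  IsMaxComp 𝒢 G G'' F =
    𝒢 F × F ∨ G ≡ G'' × (∀ F' → 𝒢 F' → F' ∨ G ≡ G'' → F ≤ F' → F' ≡ F)

  IsComp : Pred Carrier 0ℓ → Carrier → Carrier → Carrier → Set
  IsComp 𝒢 G G'' F = IsMaxComp 𝒢 G G'' F × (∀ F' → IsMaxComp 𝒢 G G'' F' → F' ≡ F)

  Composite : Pred Carrier 0ℓ → Pred Carrier 0ℓ → (Carrier → Pred Carrier 0ℓ) → Pred Carrier 0ℓ
  Composite 𝒢 S Ss H =
    S H ⊎ (Σ Carrier λ G → S G × Σ Carrier λ T → IsTau S G T ×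
             Σ Carrier λ K → Ss G K × IsComp 𝒢 T K H)

open FiniteLattice public using (Carrier; 𝟘; 𝟙)

module Submission where

-- Let A be an antichain of S ∘ (S_G) with at least two elements and join Y ∈ 𝒢, let G₀ be minimal
-- in S above Y and τ₀ = τ_S(G₀). Nestedness of S forces every a ∈ A not below τ₀ to be
-- Comp_τ₀(K) for some K ∈ S_G₀. There are at least two such a: if there were none, Y ∈ 𝒢 would
-- lie below a member of S below G₀; if only one, Y would equal it. Their K's then form an
-- antichain of S_G₀ with join Y ∨ τ₀ ∈ Ind(𝒢), contradicting nestedness of S_G₀.
-- As 𝒢 and the nested sets are arbitrary predicates, the argument runs in the double-negation
-- monad; equality and order on the finite lattice are decidable, hence stable.

open import Defs hiding (Carrier; 𝟘; 𝟙)
open import Data.Empty using (⊥; ⊥-elim)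
open import Data.Fin.Properties using (inj⇒≟)
open import Data.List using ([]; _∷_; lookup)
open import Data.List.Membership.Propositional using (_∈_)
open import Data.List.Relation.Unary.Any using (here; there; index)
open import Data.List.Relation.Unary.Any.Properties using (lookup-index)
open import Data.Product using (Σ; ∃; _×_; _,_; proj₁; proj₂)
open import Data.Sum using (inj₁; inj₂; [_,_]′)
open import Effect.Monad using (RawMonad)
open import Function using (id; _∘_)
open import Function.Bundles using (mk↣)
open import Level using (0ℓ)
open import Relation.Binary.Lattice.Bundles using (JoinSemilattice)
open import Relation.Binary.Lattice.Structures using (IsLattice)
open import Relation.Binary.PropositionalEquality using (_≡_; _≢_; refl; sym; trans; cong; subst)
open import Relation.Binary.Structures using (IsPartialOrder)
open import Relation.Nullary using (¬_; Dec; yes; no)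
open import Relation.Nullary.Decidable using (decidable-stable; ¬¬-excluded-middle)
open import Relation.Nullary.Negation using (¬¬-Monad; negated-stable; contradiction)
open import Relation.Unary using (Pred; _⊆_; ｛_｝; _∪_)
import Relation.Binary.Lattice.Properties.JoinSemilattice as JoinSemilatticeProperties
import Relation.Binary.Properties.Poset as PosetProperties

open RawMonad (¬¬-Monad {0ℓ})

module FiniteLatticeProperties (L : FiniteLattice) where
  open FiniteLattice L
  open IsLattice isLattice
    using (x≤x∨y; y≤x∨y; ∨-least; x∧y≤x; x∧y≤y; ∧-greatest; isPartialOrder; antisym)
    renaming (refl to ≤-refl; trans to ≤-trans; reflexive to ≤-reflexive)

  joinSemilattice : JoinSemilattice 0ℓ 0ℓ 0ℓ
  joinSemilattice = record { isJoinSemilattice = IsLattice.isJoinSemilattice isLattice }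

  open JoinSemilatticeProperties joinSemilattice using (∨-comm; ∨-monotonic; x≤y⇒x∨y≈y; ≈-dec⇒≤-dec)
  open PosetProperties (JoinSemilattice.poset joinSemilattice) using (≥-isPartialOrder)

  _≟_ : (x y : Carrier) → Dec (x ≡ y)
  _≟_ = inj⇒≟ (mk↣ index-injective)
    where
    index-injective : ∀ {x y} → index (complete x) ≡ index (complete y) → x ≡ y
    index-injective {x} {y} eq =
      trans (lookup-index (complete x)) (trans (cong (lookup elems) eq) (sym (lookup-index (complete y))))

  _≤?_ : (x y : Carrier) → Dec (x ≤ y)
  _≤?_ = ≈-dec⇒≤-dec _≟_

  ≡-stable : ∀ {x y} → ¬ ¬ x ≡ y → x ≡ y
  ≡-stable {x} {y} = decidable-stable (x ≟ y)

  ≤-stable : ∀ {x y} → ¬ ¬ x ≤ y → x ≤ y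
  ≤-stable {x} {y} = decidable-stable (x ≤? y)

  module MaximalElements {_⊑_ : Carrier → Carrier → Set} (⊑-isPartialOrder : IsPartialOrder _≡_ _⊑_) where
    open IsPartialOrder ⊑-isPartialOrder using ()
      renaming (refl to ⊑-refl; trans to ⊑-trans; antisym to ⊑-antisym)

    Maximal : Pred Carrier 0ℓ → Pred Carrier 0ℓ
    Maximal P m = P m × (∀ x → P x → m ⊑ x → x ≡ m)

    ¬¬-maximal-above : ∀ (P : Pred Carrier 0ℓ) {c} → P c → ¬ ¬ (∃ λ m → c ⊑ m × Maximal P m)
    ¬¬-maximal-above P {c} Pc = do
        (m , c⊑m , Pm , m-max) ← maximal-among elems
        pure (m , c⊑m , Pm , λ x → m-max x (complete x))
      where
      maximal-among : ∀ xs → ¬ ¬ (∃ λ m → c ⊑ m × P m × (∀ x → x ∈ xs → P x → m ⊑ x → x ≡ m))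
      maximal-among [] = pure (c , ⊑-refl , Pc , λ _ ())
      maximal-among (e ∷ es) = do
        (m , c⊑m , Pm , m-max) ← maximal-among es
        yes (Pe , m⊑e) ← ¬¬-excluded-middle {A = P e × m ⊑ e}
          where no e-not-above → pure (m , c⊑m , Pm , λ where
                  x (here refl) Px m⊑x → contradiction (Px , m⊑x) e-not-above
                  x (there x∈es) → m-max x x∈es)
        pure (e , ⊑-trans c⊑m m⊑e , Pe , λ where
          x (here refl) _ _ → refl
          x (there x∈es) Px e⊑x →
            let x≡m = m-max x x∈es Px (⊑-trans m⊑e e⊑x)
            in trans x≡m (⊑-antisym m⊑e (subst (e ⊑_) x≡m e⊑x)))

  open MaximalElements isPartialOrder
  open MaximalElements ≥-isPartialOrder
    renaming (Maximal to Minimal; ¬¬-maximal-above to ¬¬-minimal-below)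

  UpperBound : Pred Carrier 0ℓ → Pred Carrier 0ℓ
  UpperBound P W = ∀ Z → P Z → Z ≤ W

  -- A minimal upper bound m is least, as m ∧ W is an upper bound below m.
  ¬¬-join : ∀ (P : Pred Carrier 0ℓ) → ¬ ¬ (∃ (IsJoinOf P))
  ¬¬-join P = do
    (m , _ , m-ub , m-min) ← ¬¬-minimal-below (UpperBound P) (λ Z _ → maximum Z)
    pure (m , m-ub , λ W W-ub →
      let m∧W≡m = m-min (m ∧ W) (λ Z PZ → ∧-greatest (m-ub Z PZ) (W-ub Z PZ)) (x∧y≤x m W)
      in subst (_≤ W) m∧W≡m (x∧y≤y m W))

  join-unique : ∀ {P Y Y′} → IsJoinOf P Y → IsJoinOf P Y′ → Y ≡ Y′
  join-unique (Y-ub , Y-least) (Y′-ub , Y′-least) = antisym (Y-least _ Y′-ub) (Y′-least _ Y-ub)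

  maximals-join : ∀ {B X} → IsJoinOf B X → IsJoinOf (Maximal B) X
  maximals-join {B} (X-ub , X-least) =
    (λ m (Bm , _) → X-ub m Bm) , λ W W-ub → X-least W λ c Bc → ≤-stable do
      (m , c≤m , m-max) ← ¬¬-maximal-above B Bc
      pure (≤-trans c≤m (W-ub m m-max))

  maximals-antichain : ∀ {B} → IsAntichain L (Maximal B)
  maximals-antichain x y (_ , x-max) (By , _) x≤y = sym (x-max y By x≤y)

  comp≤ : ∀ {𝒢 T K a} → IsMaxComp L 𝒢 T K a → a ≤ K
  comp≤ {T = T} {a = a} (_ , a∨T≡K , _) = ≤-trans (x≤x∨y a T) (≤-reflexive a∨T≡K)

  base≤ : ∀ {𝒢 T K a} → IsMaxComp L 𝒢 T K a → T ≤ K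
  base≤ {T = T} {a = a} (_ , a∨T≡K , _) = ≤-trans (y≤x∨y a T) (≤-reflexive a∨T≡K)

  self-comp : ∀ {𝒢 : Pred Carrier 0ℓ} {T a} → 𝒢 a → T ≤ a → IsMaxComp L 𝒢 T a a
  self-comp {T = T} 𝒢a T≤a =
    𝒢a , trans (∨-comm _ T) (x≤y⇒x∨y≈y T≤a) ,
    λ F _ F∨T≡a a≤F → antisym (≤-trans (x≤x∨y F T) (≤-reflexive F∨T≡a)) a≤F

  τ≤ : ∀ {S G T} → IsTau L S G T → T ≤ G
  τ≤ {G = G} T-tau = proj₂ T-tau G λ _ (_ , G′≤G , _) → G′≤G

  _[_≔_] : (Carrier → Carrier) → Carrier → Carrier → Carrier → Carrier
  (f [ F ≔ v ]) G with G ≟ F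
  ... | yes _ = v
  ... | no _ = f G

  [≔]-elim : ∀ (Q : Carrier → Set) {f F v G} → (G ≡ F → Q v) → (G ≢ F → Q (f G)) → Q ((f [ F ≔ v ]) G)
  [≔]-elim Q {F = F} {G = G} at-F elsewhere with G ≟ F
  ... | yes G≡F = at-F G≡F
  ... | no G≢F = elsewhere G≢F

  [≔]-≡ : ∀ {f F v} → (f [ F ≔ v ]) F ≡ v
  [≔]-≡ {v = v} = [≔]-elim (_≡ v) (λ _ → refl) (contradiction refl)

  [≔]-≢ : ∀ {f F v G} → G ≢ F → (f [ F ≔ v ]) G ≡ f G
  [≔]-≢ {f} {G = G} G≢F = [≔]-elim (_≡ f G) (λ G≡F → contradiction G≡F G≢F) (λ _ → refl)

  module BuildingSetProperties {𝒢 : Pred Carrier 0ℓ} (building : IsBuildingSet L 𝒢) where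

    decompose : ∀ X {Y} → Y ≤ X → Σ (Carrier → Carrier) λ φ → InProd L 𝒢 X φ × IsJoinOf (Img L 𝒢 X φ) Y
    decompose X = proj₁ (proj₂ building X) _

    decomposition-mono : ∀ {X φ ψ Y Z} → InProd L 𝒢 X φ → InProd L 𝒢 X ψ →
      IsJoinOf (Img L 𝒢 X φ) Y → IsJoinOf (Img L 𝒢 X ψ) Z → Y ≤ Z → ∀ G → Fact L 𝒢 X G → φ G ≤ ψ G
    decomposition-mono {X} {φ} {ψ} {Y} {Z} φ∈ ψ∈ φ-join ψ-join =
      proj₁ (proj₂ (proj₂ building X) φ ψ Y Z φ∈ ψ∈ φ-join ψ-join)

    below-𝟘⇒∉𝒢 : ∀ {y} → y ≤ 𝟘 → ¬ 𝒢 y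
    below-𝟘⇒∉𝒢 {y} y≤𝟘 𝒢y = proj₁ building (subst 𝒢 (antisym y≤𝟘 (minimum y)) 𝒢y)

    ¬¬-below-factor : ∀ {F X} → 𝒢 F → F ≤ X → ¬ ¬ (∃ λ G → Fact L 𝒢 X G × F ≤ G)
    ¬¬-below-factor {X = X} 𝒢F F≤X = do
      (G , F≤G , (𝒢G , G≤X) , G-max) ← ¬¬-maximal-above (λ Z → 𝒢 Z × Z ≤ X) (𝒢F , F≤X)
      pure (G , (𝒢G , G≤X , λ H 𝒢H H≤X → G-max H (𝒢H , H≤X)) , F≤G)

    point : Carrier → Carrier → Carrier
    point F = (λ _ → 𝟘) [ F ≔ F ]

    point-inProd : ∀ {X F} → InProd L 𝒢 X (point F)
    point-inProd G _ = [≔]-elim (_≤ G) (λ G≡F → ≤-reflexive (sym G≡F)) (λ _ → minimum G)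

    point-join : ∀ {X F} → Fact L 𝒢 X F → IsJoinOf (Img L 𝒢 X (point F)) F
    point-join {F = F} F-fact =
      (λ { _ (G , _ , refl) → [≔]-elim (_≤ F) (λ _ → ≤-refl) (λ _ → minimum F) }) ,
      λ W W-ub → subst (_≤ W) [≔]-≡ (W-ub _ (F , F-fact , refl))

    factors-disjoint : ∀ {X F₁ F₂ y} → Fact L 𝒢 X F₁ → Fact L 𝒢 X F₂ → F₁ ≢ F₂ → y ≤ F₁ → y ≤ F₂ → y ≤ 𝟘
    factors-disjoint {X} {F₁} {F₂} {y} F₁-fact F₂-fact F₁≢F₂ y≤F₁ y≤F₂
      with decompose X (≤-trans y≤F₁ (proj₁ (proj₂ F₁-fact)))
    ... | φ , φ∈ , φ-join = proj₂ φ-join 𝟘 λ { _ (G , G-fact , refl) → component-𝟘 G G-fact }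
      where
      φ≤point : ∀ {F} → Fact L 𝒢 X F → y ≤ F → ∀ G → Fact L 𝒢 X G → φ G ≤ point F G
      φ≤point F-fact = decomposition-mono φ∈ point-inProd φ-join (point-join F-fact)

      component-𝟘 : ∀ G → Fact L 𝒢 X G → φ G ≤ 𝟘
      component-𝟘 G G-fact with G ≟ F₁
      ... | yes refl = subst (φ G ≤_) ([≔]-≢ F₁≢F₂) (φ≤point F₂-fact y≤F₂ G G-fact)
      ... | no G≢F₁ = subst (φ G ≤_) ([≔]-≢ G≢F₁) (φ≤point F₁-fact y≤F₁ G G-fact)

    factors-join : ∀ {X} → IsJoinOf (Img L 𝒢 X id) X
    factors-join {X} with decompose X ≤-refl
    ... | φ , φ∈ , (_ , φ-least) =
      (λ { _ (G , G-fact , refl) → proj₁ (proj₂ G-fact) }) ,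
      λ W W-ub → φ-least W λ { _ (G , G-fact , refl) → ≤-trans (φ∈ G G-fact) (W-ub G (G , G-fact , refl)) }

    -- Replacing the component F by W ∧ F still decomposes X, so the injectivity of the join map gives F ≤ W ∧ F.
    factor-join-below : ∀ {B X F} → B ⊆ 𝒢 → IsJoinOf B X → Fact L 𝒢 X F → IsJoinOf (λ c → B c × c ≤ F) F
    factor-join-below {B} {X} {F} B⊆𝒢 (X-ub , X-least) F-fact = (λ _ (_ , c≤F) → c≤F) , F-least
      where
      F-least : ∀ W → UpperBound (λ c → B c × c ≤ F) W → F ≤ W
      F-least W W-ub = ≤-trans F≤W∧F (x∧y≤x W F)
        where
        ψ : Carrier → Carrier
        ψ = id [ F ≔ W ∧ F ]

        ψ∈ : InProd L 𝒢 X ψ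
        ψ∈ G _ = [≔]-elim (_≤ G) (λ G≡F → ≤-trans (x∧y≤y W F) (≤-reflexive (sym G≡F))) (λ _ → ≤-refl)

        generator≤ : ∀ V → UpperBound (Img L 𝒢 X ψ) V → UpperBound B V
        generator≤ V V-ub b Bb with b ≤? F
        ... | yes b≤F =
          ≤-trans (∧-greatest (W-ub b (Bb , b≤F)) b≤F) (subst (_≤ V) [≔]-≡ (V-ub _ (F , F-fact , refl)))
        ... | no b≰F = ≤-stable do
          (Fb , Fb-fact , b≤Fb) ← ¬¬-below-factor (B⊆𝒢 Bb) (X-ub b Bb)
          let Fb≢F = λ Fb≡F → b≰F (subst (b ≤_) Fb≡F b≤Fb)
          pure (≤-trans b≤Fb (subst (_≤ V) ([≔]-≢ Fb≢F) (V-ub _ (Fb , Fb-fact , refl))))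

        ψ-join : IsJoinOf (Img L 𝒢 X ψ) X
        ψ-join = (λ { _ (G , G-fact , refl) → ≤-trans (ψ∈ G G-fact) (proj₁ (proj₂ G-fact)) }) ,
                 λ V V-ub → X-least V (generator≤ V V-ub)

        F≤W∧F : F ≤ W ∧ F
        F≤W∧F = subst (F ≤_) [≔]-≡ (decomposition-mono (λ _ _ → ≤-refl) ψ∈ factors-join ψ-join ≤-refl F F-fact)

    ∨∉𝒢⇒disjoint : ∀ {G₁ G₂ a} → 𝒢 G₁ → 𝒢 G₂ → ¬ 𝒢 (G₁ ∨ G₂) → a ≤ G₁ → a ≤ G₂ → ¬ 𝒢 a
    ∨∉𝒢⇒disjoint {G₁} {G₂} {a} 𝒢G₁ 𝒢G₂ ∨∉𝒢 a≤G₁ a≤G₂ = negated-stable do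
        (F₁ , F₁-fact , G₁≤F₁) ← ¬¬-below-factor 𝒢G₁ (x≤x∨y G₁ G₂)
        (F₂ , F₂-fact , G₂≤F₂) ← ¬¬-below-factor 𝒢G₂ (y≤x∨y G₁ G₂)
        pure (separate F₁-fact F₂-fact G₁≤F₁ G₂≤F₂ (F₁ ≟ F₂))
      where
      separate : ∀ {F₁ F₂} → Fact L 𝒢 (G₁ ∨ G₂) F₁ → Fact L 𝒢 (G₁ ∨ G₂) F₂ →
                 G₁ ≤ F₁ → G₂ ≤ F₂ → Dec (F₁ ≡ F₂) → ¬ 𝒢 a
      separate (𝒢F , F≤G₁∨G₂ , _) _ G₁≤F G₂≤F (yes refl) _ =
        ∨∉𝒢 (subst 𝒢 (antisym F≤G₁∨G₂ (∨-least G₁≤F G₂≤F)) 𝒢F)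
      separate F₁-fact F₂-fact G₁≤F₁ G₂≤F₂ (no F₁≢F₂) =
        below-𝟘⇒∉𝒢 (factors-disjoint F₁-fact F₂-fact F₁≢F₂ (≤-trans a≤G₁ G₁≤F₁) (≤-trans a≤G₂ G₂≤F₂))

    -- In K = b ∨ T the factor containing b is b itself (by maximality of b), while any other
    -- factor is generated by elements of B alone and so lies below T.
    ¬¬-≤-comp : ∀ {B T K a b} → B ⊆ 𝒢 → IsJoinOf B T → 𝒢 a → ¬ a ≤ T → IsMaxComp L 𝒢 T K b → a ≤ K → ¬ ¬ a ≤ b
    ¬¬-≤-comp {B} {T} {K} {a} {b} B⊆𝒢 (T-ub , T-least) 𝒢a a≰T b-comp@(𝒢b , b∨T≡K , b-max) a≤K = do
        (F , F-fact , a≤F) ← ¬¬-below-factor 𝒢a a≤K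
        (Fb , Fb-fact , b≤Fb) ← ¬¬-below-factor 𝒢b b≤K
        pure (compare F-fact a≤F Fb-fact b≤Fb (F ≟ Fb))
      where
      b≤K : b ≤ K
      b≤K = comp≤ b-comp

      T≤K : T ≤ K
      T≤K = base≤ b-comp

      K-join : IsJoinOf (｛ b ｝ ∪ B) K
      K-join = (λ { _ (inj₁ refl) → b≤K ; c (inj₂ Bc) → ≤-trans (T-ub c Bc) T≤K }) ,
               λ W W-ub → subst (_≤ W) b∨T≡K (∨-least (W-ub b (inj₁ refl)) (T-least W λ c Bc → W-ub c (inj₂ Bc)))

      compare : ∀ {F Fb} → Fact L 𝒢 K F → a ≤ F → Fact L 𝒢 K Fb → b ≤ Fb → Dec (F ≡ Fb) → a ≤ b
      compare {Fb = Fb} _ a≤Fb (𝒢Fb , Fb≤K , _) b≤Fb (yes refl) = subst (a ≤_) (b-max Fb 𝒢Fb Fb∨T≡K b≤Fb) a≤Fb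
        where
        Fb∨T≡K : Fb ∨ T ≡ K
        Fb∨T≡K = antisym (∨-least Fb≤K T≤K) (subst (_≤ _) b∨T≡K (∨-monotonic b≤Fb ≤-refl))
      compare {F = F} F-fact a≤F Fb-fact b≤Fb (no F≢Fb) = contradiction (≤-trans a≤F F≤T) a≰T
        where
        F≤T : F ≤ T
        F≤T = proj₂ (factor-join-below [ (λ { refl → 𝒢b }) , B⊆𝒢 ]′ K-join F-fact) T λ where
          _ (inj₁ refl , b≤F) → contradiction 𝒢b (below-𝟘⇒∉𝒢 (factors-disjoint F-fact Fb-fact F≢Fb b≤F b≤Fb))
          c (inj₂ Bc , _) → T-ub c Bc

    module NestedSetProperties {S : Pred Carrier 0ℓ} (nested : IsNested L 𝒢 S) where

      S⊆𝒢 : S ⊆ 𝒢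
      S⊆𝒢 = proj₁ nested

      -- The maximal elements of B are an antichain with join F, so nestedness leaves only one of them.
      ¬¬-join∈ : ∀ {B F} → B ⊆ S → IsJoinOf B F → 𝒢 F → ¬ ¬ B F
      ¬¬-join∈ {B} {F} B⊆S F-join 𝒢F = do
        yes (c , Bc) ← ¬¬-excluded-middle {A = ∃ B}
          where no ∄B → contradiction 𝒢F (below-𝟘⇒∉𝒢 (proj₂ F-join 𝟘 λ c Bc → contradiction (c , Bc) ∄B))
        (m , _ , m-max) ← ¬¬-maximal-above B Bc
        no ¬two ← ¬¬-excluded-middle {A = AtLeastTwo L (Maximal B)}
          where yes two → contradiction 𝒢F (proj₂ nested (Maximal B) (B⊆S ∘ proj₁) maximals-antichain two F
                                                       (maximals-join F-join))
        let below-m : UpperBound B m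
            below-m c Bc = ≤-stable do
              (m′ , c≤m′ , m′-max) ← ¬¬-maximal-above B Bc
              pure (subst (c ≤_) (≡-stable λ m′≢m → ¬two (m′ , m , m′-max , m-max , m′≢m)) c≤m′)
        pure (subst B (antisym (proj₁ F-join m (proj₁ m-max)) (proj₂ F-join m below-m)) (proj₁ m-max))

      ¬¬-below-member : ∀ {B X H} → B ⊆ S → IsJoinOf B X → 𝒢 H → H ≤ X → ¬ ¬ (∃ λ b → B b × H ≤ b)
      ¬¬-below-member B⊆S X-join 𝒢H H≤X = do
        (F , F-fact , H≤F) ← ¬¬-below-factor 𝒢H H≤X
        (BF , _) ← ¬¬-join∈ (B⊆S ∘ proj₁) (factor-join-below (S⊆𝒢 ∘ B⊆S) X-join F-fact) (proj₁ F-fact)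
        pure (F , BF , H≤F)

      incomparable⇒∨∉𝒢 : ∀ {G₁ G₂} → S G₁ → S G₂ → ¬ G₁ ≤ G₂ → ¬ G₂ ≤ G₁ → ¬ 𝒢 (G₁ ∨ G₂)
      incomparable⇒∨∉𝒢 {G₁} {G₂} SG₁ SG₂ G₁≰G₂ G₂≰G₁ =
        proj₂ nested (｛ G₁ ｝ ∪ ｛ G₂ ｝) [ (λ { refl → SG₁ }) , (λ { refl → SG₂ }) ]′ pair-antichain
          (G₁ , G₂ , inj₁ refl , inj₂ refl , G₁≰G₂ ∘ ≤-reflexive) (G₁ ∨ G₂) pair-join
        where
        pair-antichain : IsAntichain L (｛ G₁ ｝ ∪ ｛ G₂ ｝)
        pair-antichain _ _ (inj₁ refl) (inj₁ refl) _ = refl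
        pair-antichain _ _ (inj₂ refl) (inj₂ refl) _ = refl
        pair-antichain _ _ (inj₁ refl) (inj₂ refl) G₁≤G₂ = contradiction G₁≤G₂ G₁≰G₂
        pair-antichain _ _ (inj₂ refl) (inj₁ refl) G₂≤G₁ = contradiction G₂≤G₁ G₂≰G₁

        pair-join : IsJoinOf (｛ G₁ ｝ ∪ ｛ G₂ ｝) (G₁ ∨ G₂)
        pair-join = (λ { _ (inj₁ refl) → x≤x∨y G₁ G₂ ; _ (inj₂ refl) → y≤x∨y G₁ G₂ }) ,
                    λ W W-ub → ∨-least (W-ub G₁ (inj₁ refl)) (W-ub G₂ (inj₂ refl))

      module Composition (S𝟙 : S 𝟙) (Ss : Carrier → Pred Carrier 0ℓ)
        (Ss-nested : ∀ G T → S G → IsTau L S G T → IsNested L (Ind L 𝒢 T G) (Ss G) × Ss G G) where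

        ComponentOf : Carrier → Carrier → Carrier → Set
        ComponentOf G T a = ∃ λ K → Ss G K × IsMaxComp L 𝒢 T K a

        composite⊆𝒢 : Composite L 𝒢 S Ss ⊆ 𝒢
        composite⊆𝒢 (inj₁ Sa) = S⊆𝒢 Sa
        composite⊆𝒢 (inj₂ (_ , _ , _ , _ , _ , _ , (𝒢a , _) , _)) = 𝒢a

        ¬¬-componentOf : ∀ {a} → Composite L 𝒢 S Ss a →
                         ¬ ¬ (∃ λ G → S G × ∃ λ T → IsTau L S G T × ComponentOf G T a)
        ¬¬-componentOf (inj₂ (G , SG , T , T-tau , K , SsK , a-comp , _)) =
          pure (G , SG , T , T-tau , K , SsK , a-comp)
        ¬¬-componentOf {a} (inj₁ Sa) = do
          (T , T-tau) ← ¬¬-join _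
          pure (a , Sa , T , T-tau , a , proj₂ (Ss-nested a T Sa T-tau) , self-comp (S⊆𝒢 Sa) (τ≤ T-tau))

        component-bounds : ∀ {G T a} → S G → IsTau L S G T → ComponentOf G T a → a ≤ G × ¬ a ≤ T
        component-bounds SG T-tau (K , SsK , a-comp@(_ , a∨T≡K , _)) =
          let (_ , _ , K≤G , K≢T) = proj₁ (proj₁ (Ss-nested _ _ SG T-tau)) SsK
          in ≤-trans (comp≤ a-comp) K≤G , λ a≤T → K≢T (trans (sym a∨T≡K) (x≤y⇒x∨y≈y a≤T))

        module _ {A : Pred Carrier 0ℓ} (A⊆ : A ⊆ Composite L 𝒢 S Ss) (A-antichain : IsAntichain L A)
                 (A-two : AtLeastTwo L A) {Y} (Y-join : IsJoinOf A Y) (𝒢Y : 𝒢 Y)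
                 {G₀} (G₀-min : Minimal (λ G → S G × Y ≤ G) G₀) {τ₀} (τ₀-tau : IsTau L S G₀ τ₀) where

          SG₀ : S G₀
          SG₀ = proj₁ (proj₁ G₀-min)

          a≤G₀ : ∀ {a} → A a → a ≤ G₀
          a≤G₀ Aa = ≤-trans (proj₁ Y-join _ Aa) (proj₂ (proj₁ G₀-min))

          Above : Pred Carrier 0ℓ
          Above a = A a × ¬ a ≤ τ₀

          -- Elements of S below G₀ lie under τ₀, those above G₀ have their τ above a,
          -- and incomparable ones share no element of 𝒢 with G₀.
          ¬¬-component : ∀ {a} → Above a → ¬ ¬ ComponentOf G₀ τ₀ a
          ¬¬-component {a} (Aa , a≰τ₀) = do
              (G , SG , T , T-tau , a-comp) ← ¬¬-componentOf (A⊆ Aa)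
              pure (relocate SG T-tau a-comp (component-bounds SG T-tau a-comp) (G ≟ G₀) (G ≤? G₀) (G₀ ≤? G))
            where
            relocate : ∀ {G T} → S G → IsTau L S G T → ComponentOf G T a → a ≤ G × ¬ a ≤ T →
                       Dec (G ≡ G₀) → Dec (G ≤ G₀) → Dec (G₀ ≤ G) → ComponentOf G₀ τ₀ a
            relocate _ T-tau a-comp _ (yes refl) _ _ =
              subst (λ T → ComponentOf G₀ T a) (join-unique T-tau τ₀-tau) a-comp
            relocate SG _ _ (a≤G , _) (no G≢G₀) (yes G≤G₀) _ =
              contradiction (≤-trans a≤G (proj₁ τ₀-tau _ (SG , G≤G₀ , G≢G₀))) a≰τ₀
            relocate _ T-tau _ (_ , a≰T) (no G≢G₀) _ (yes G₀≤G) =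
              contradiction (≤-trans (a≤G₀ Aa) (proj₁ T-tau G₀ (SG₀ , G₀≤G , G≢G₀ ∘ sym))) a≰T
            relocate SG _ _ (a≤G , _) (no _) (no G≰G₀) (no G₀≰G) =
              ⊥-elim (∨∉𝒢⇒disjoint (S⊆𝒢 SG) (S⊆𝒢 SG₀) (incomparable⇒∨∉𝒢 SG SG₀ G≰G₀ G₀≰G) a≤G (a≤G₀ Aa)
                                  (composite⊆𝒢 (A⊆ Aa)))

          ¬¬-some-above : ¬ ¬ (∃ Above)
          ¬¬-some-above ∄above = ¬¬-below-member proj₁ τ₀-tau 𝒢Y Y≤τ₀
              λ (G , (SG , G≤G₀ , G≢G₀) , Y≤G) → G≢G₀ (proj₂ G₀-min G (SG , Y≤G) G≤G₀)
            where
            Y≤τ₀ : Y ≤ τ₀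
            Y≤τ₀ = proj₂ Y-join τ₀ λ a Aa → ≤-stable λ a≰τ₀ → ∄above (a , Aa , a≰τ₀)

          -- Were a₀ the only element of A above τ₀, then Y ∨ τ₀ = a₀ ∨ τ₀ and maximality of a₀ gives Y = a₀.
          ¬¬-another-above : ∀ {a₀} → Above a₀ → ComponentOf G₀ τ₀ a₀ → ¬ ¬ (∃ λ a₁ → Above a₁ × a₁ ≢ a₀)
          ¬¬-another-above {a₀} (Aa₀ , _) (K₀ , _ , a₀-comp@(_ , a₀∨τ₀≡K₀ , a₀-max)) ∄other =
              let (x , z , Ax , Az , x≢z) = A-two in x≢z (trans (A≡a₀ Ax) (sym (A≡a₀ Az)))
            where
            below-K₀ : UpperBound A K₀
            below-K₀ a Aa with a ≤? τ₀
            ... | yes a≤τ₀ = ≤-trans a≤τ₀ (base≤ a₀-comp)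
            ... | no a≰τ₀ =
              subst (_≤ K₀) (sym (≡-stable λ a≢a₀ → ∄other (a , (Aa , a≰τ₀) , a≢a₀))) (comp≤ a₀-comp)

            Y∨τ₀≡K₀ : Y ∨ τ₀ ≡ K₀
            Y∨τ₀≡K₀ = antisym (∨-least (proj₂ Y-join K₀ below-K₀) (base≤ a₀-comp))
                              (subst (_≤ Y ∨ τ₀) a₀∨τ₀≡K₀ (∨-monotonic (proj₁ Y-join a₀ Aa₀) ≤-refl))

            A≡a₀ : ∀ {a} → A a → a ≡ a₀
            A≡a₀ Aa = A-antichain _ _ Aa Aa₀
              (subst (_ ≤_) (a₀-max Y 𝒢Y Y∨τ₀≡K₀ (proj₁ Y-join a₀ Aa₀)) (proj₁ Y-join _ Aa))

          comps-≤⇒≡ : ∀ {a b Ka Kb} → Above a → A b →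
                      IsMaxComp L 𝒢 τ₀ Ka a → IsMaxComp L 𝒢 τ₀ Kb b → Ka ≤ Kb → a ≡ b
          comps-≤⇒≡ (Aa , a≰τ₀) Ab a-comp b-comp Ka≤Kb = ≡-stable do
            a≤b ← ¬¬-≤-comp (S⊆𝒢 ∘ proj₁) τ₀-tau (composite⊆𝒢 (A⊆ Aa)) a≰τ₀ b-comp
                            (≤-trans (comp≤ a-comp) Ka≤Kb)
            pure (A-antichain _ _ Aa Ab a≤b)

          Components : Pred Carrier 0ℓ
          Components K = ∃ λ a → Above a × Ss G₀ K × IsMaxComp L 𝒢 τ₀ K a

          components-antichain : IsAntichain L Components
          components-antichain _ _ (_ , above-a , _ , a-comp) (_ , (Ab , _) , _ , b-comp) Ka≤Kb =
            trans (sym (proj₁ (proj₂ a-comp)))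
                  (trans (cong (_∨ τ₀) (comps-≤⇒≡ above-a Ab a-comp b-comp Ka≤Kb)) (proj₁ (proj₂ b-comp)))

          components-join : ∀ {K₀} → Components K₀ → IsJoinOf Components (Y ∨ τ₀)
          components-join {K₀} K₀-component@(_ , _ , _ , a₀-comp) = Y∨τ₀-ub , Y∨τ₀-least
            where
            Y∨τ₀-ub : UpperBound Components (Y ∨ τ₀)
            Y∨τ₀-ub _ (a , (Aa , _) , _ , (_ , a∨τ₀≡K , _)) =
              subst (_≤ Y ∨ τ₀) a∨τ₀≡K (∨-monotonic (proj₁ Y-join a Aa) ≤-refl)

            Y∨τ₀-least : ∀ W → UpperBound Components W → Y ∨ τ₀ ≤ W
            Y∨τ₀-least W W-ub = ∨-least (proj₂ Y-join W below-W) τ₀≤W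
              where
              τ₀≤W : τ₀ ≤ W
              τ₀≤W = ≤-trans (base≤ a₀-comp) (W-ub K₀ K₀-component)

              below-W : UpperBound A W
              below-W a Aa with a ≤? τ₀
              ... | yes a≤τ₀ = ≤-trans a≤τ₀ τ₀≤W
              ... | no a≰τ₀ = ≤-stable do
                (K , SsK , a-comp) ← ¬¬-component (Aa , a≰τ₀)
                pure (≤-trans (comp≤ a-comp) (W-ub K (a , (Aa , a≰τ₀) , SsK , a-comp)))

          two-above⇒⊥ : ∀ {a₀ a₁} → Above a₀ → ComponentOf G₀ τ₀ a₀ →
                        Above a₁ → ComponentOf G₀ τ₀ a₁ → a₁ ≢ a₀ → ⊥
          two-above⇒⊥ {a₀} {a₁} above₀ (K₀ , SsK₀ , a₀-comp) above₁ (K₁ , SsK₁ , a₁-comp) a₁≢a₀ =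
            proj₂ (proj₁ (Ss-nested G₀ τ₀ SG₀ τ₀-tau)) Components (λ (_ , _ , SsK , _) → SsK) components-antichain
              (K₀ , K₁ , K₀-component , K₁-component , K₀≢K₁) (Y ∨ τ₀) (components-join K₀-component) Y∨τ₀∈Ind
            where
            K₀-component : Components K₀
            K₀-component = a₀ , above₀ , SsK₀ , a₀-comp

            K₁-component : Components K₁
            K₁-component = a₁ , above₁ , SsK₁ , a₁-comp

            K₀≢K₁ : K₀ ≢ K₁
            K₀≢K₁ K₀≡K₁ = a₁≢a₀ (sym (comps-≤⇒≡ above₀ (proj₁ above₁) a₀-comp a₁-comp (≤-reflexive K₀≡K₁)))

            Y∨τ₀∈Ind : Ind L 𝒢 τ₀ G₀ (Y ∨ τ₀)
            Y∨τ₀∈Ind = (Y , 𝒢Y , ∨-comm τ₀ Y) , y≤x∨y Y τ₀ , ∨-least (proj₂ (proj₁ G₀-min)) (τ≤ τ₀-tau) ,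
                       λ Y∨τ₀≡τ₀ → proj₂ above₀ (≤-trans (proj₁ Y-join a₀ (proj₁ above₀))
                                                         (≤-trans (x≤x∨y Y τ₀) (≤-reflexive Y∨τ₀≡τ₀)))

          ¬¬-absurd : ¬ ¬ ⊥
          ¬¬-absurd = do
            (a₀ , above₀) ← ¬¬-some-above
            a₀-component ← ¬¬-component above₀
            (a₁ , above₁ , a₁≢a₀) ← ¬¬-another-above above₀ a₀-component
            a₁-component ← ¬¬-component above₁
            pure (two-above⇒⊥ above₀ a₀-component above₁ a₁-component a₁≢a₀)

        composite-nested : IsNested L 𝒢 (Composite L 𝒢 S Ss)
        composite-nested = composite⊆𝒢 , λ A A⊆ A-antichain A-two Y Y-join 𝒢Y → run do
          (G₀ , _ , G₀-min) ← ¬¬-minimal-below (λ G → S G × Y ≤ G) (S𝟙 , maximum Y)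
          (τ₀ , τ₀-tau) ← ¬¬-join _
          ¬¬-absurd A⊆ A-antichain A-two Y-join 𝒢Y G₀-min τ₀-tau
          where
          run : ¬ ¬ ⊥ → ⊥
          run k = k id

open FiniteLattice using (Carrier; 𝟘; 𝟙)

mainTheorem3 : (L : FiniteLattice) → IsGeometric L →
    (𝒢 : Pred (Carrier L) 0ℓ) → IsBuildingSet L 𝒢 → 𝒢 (𝟙 L) →
    (S : Pred (Carrier L) 0ℓ) → IsNested L 𝒢 S → S (𝟙 L) →
    (Ss : Carrier L → Pred (Carrier L) 0ℓ) →
    (∀ G T → S G → IsTau L S G T → IsNested L (Ind L 𝒢 T G) (Ss G) × Ss G G) →
    IsNested L 𝒢 (Composite L 𝒢 S Ss)
mainTheorem3 L _ 𝒢 building _ S nested S𝟙 Ss Ss-nested = composite-nested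
  where
  open FiniteLatticeProperties L
  open BuildingSetProperties building
  open NestedSetProperties nested
  open Composition S𝟙 Ss Ss-nested
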